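{- Let $G$ be a chordal graph on $n$ vertices, let $\sigma=(v_1,v_2,\ldots,v_n)$ be a perfect elimination order of $G$, and let $k<n$ be a positive integer. For each $i$, let $G_i$ be the subgraph of $G$ induced by $\{v_i,v_{i+1},\ldots,v_n\}$. Then $G$ is $k$-connected if and only if $|N_{G_i}(v_i)|\ge k$ for all $1\le i\le n-k$.
   Context: All graphs are finite and simple. $N_H(v)$ denotes the set of neighbors of $v$ in the graph $H$. A graph is chordal if every cycle of length greater than three has a chord. A vertex is simplicial in a graph if its closed neighborhood is a clique. An ordering $(v_1,\ldots,v_n)$ of $V(G)$ is a perfect elimination order if each $v_i$ is a simplicial vertex of $G_i$, where $G_i$ is the subgraph induced by $\{v_i,\ldots,v_n\}$. A separating set of $G$ is a set $S\subseteq V(G)$ such that $G-S$ has more than one component; $G$ is $k$-connected if it contains no separating set of size less than $k$. -}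

module Defs where

open import Data.Nat using (ℕ; zero; suc; _+_; _<_; _≤_)
import Data.Nat
import Data.Fin
import Data.Bool
open import Data.Fin using (Fin; toℕ)
open import Data.Fin.Subset using (Subset; _∈_; _∉_; ∣_∣)
open import Data.Fin.Permutation using (Permutation′; _⟨$⟩ʳ_)
open import Data.Vec using (tabulate)
open import Data.Bool using (Bool; true; false)
open import Data.Product using (Σ; _×_; ∃-syntax)
open import Data.Sum using (_⊎_)
open import Relation.Nullary using (¬_; Dec; does)
open import Relation.Binary.PropositionalEquality using (_≡_; _≢_)
open import Function.Definitions using (Injective)

record Graph (n : ℕ) : Set₁ where
  field
    Adj   : Fin n → Fin n → Set
    adj?  : ∀ u v → Dec (Adj u v)
    sym   : ∀ {u v} → Adj u v → Adj v u
    irrefl : ∀ {u} → ¬ Adj u u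

open Graph public

record Cycle {n : ℕ} (G : Graph n) (m : ℕ) : Set where
  field
    vtx      : Fin m → Fin n
    distinct : Injective _≡_ _≡_ vtx
    step     : ∀ (i j : Fin m) → suc (toℕ i) ≡ toℕ j → Adj G (vtx i) (vtx j)
    close    : ∀ (i j : Fin m) → suc (toℕ i) ≡ m → toℕ j ≡ 0 → Adj G (vtx i) (vtx j)

open Cycle public

Consecutive : (m : ℕ) → Fin m → Fin m → Set
Consecutive m i j =
  suc (toℕ i) ≡ toℕ j ⊎ suc (toℕ j) ≡ toℕ i
  ⊎ (suc (toℕ i) ≡ m × toℕ j ≡ 0) ⊎ (suc (toℕ j) ≡ m × toℕ i ≡ 0)

HasChord : ∀ {n m} (G : Graph n) → Cycle G m → Set
HasChord {m = m} G C =
  ∃[ i ] ∃[ j ] (i ≢ j × ¬ Consecutive m i j × Adj G (vtx C i) (vtx C j))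

Chordal : ∀ {n} → Graph n → Set
Chordal G = ∀ m → 3 Data.Nat.< m → (C : Cycle G m) → HasChord G C

-- The vertex v_i = σ(i); G_i is induced by {σ j | i ≤ j}.
-- σ(i) is simplicial in G_i: its closed neighbourhood in G_i is a clique.
SimplicialIn : ∀ {n} → Graph n → Permutation′ n → Fin n → Set
SimplicialIn {n} G σ i =
  ∀ (j l : Fin n) → i Data.Fin.≤ j → i Data.Fin.≤ l →
  (j ≡ i ⊎ Adj G (σ ⟨$⟩ʳ i) (σ ⟨$⟩ʳ j)) →
  (l ≡ i ⊎ Adj G (σ ⟨$⟩ʳ i) (σ ⟨$⟩ʳ l)) →
  j ≢ l → Adj G (σ ⟨$⟩ʳ j) (σ ⟨$⟩ʳ l)

PerfectEliminationOrder : ∀ {n} → Graph n → Permutation′ n → Set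
PerfectEliminationOrder G σ = ∀ i → SimplicialIn G σ i


NbrInGi : ∀ {n} → Graph n → Permutation′ n → Fin n → Subset n
NbrInGi {n} G σ i =
  tabulate (λ u → does (adj? G (σ ⟨$⟩ʳ i) u) Data.Bool.∧ isLater u)
  where
    open Data.Fin.Permutation using (_⟨$⟩ˡ_)
    isLater : Fin n → Bool
    isLater u = does (i Data.Fin.<? (σ ⟨$⟩ˡ u))

data ReachAvoiding {n : ℕ} (G : Graph n) (S : Subset n) : Fin n → Fin n → Set where
  here  : ∀ {u} → u ∉ S → ReachAvoiding G S u u
  there : ∀ {u v w} → u ∉ S → Adj G u v → ReachAvoiding G S v w → ReachAvoiding G S u w

Separating : ∀ {n} → Graph n → Subset n → Set
Separating G S = ∃[ u ] ∃[ w ] (u ∉ S × w ∉ S × ¬ ReachAvoiding G S u w)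

KConnected : ∀ {n} → ℕ → Graph n → Set
KConnected {n} k G = ∀ (S : Subset n) → ∣ S ∣ Data.Nat.< k → ¬ Separating G S

-- (⇒) If v_i had fewer than k later neighbours, its later neighbourhood N
-- would miss one of v_{i+1}, …, v_{i+k}, say w, and N would separate v_i
-- from w.  Indeed, a walk in G − N from v_i to w can be cleared of all
-- vertices earlier than v_i, one position at a time: v_d is simplicial in
-- G_d, so its two neighbours on a walk inside G_d are adjacent and v_d can
-- be bypassed.  The cleared walk then leaves v_i through a later neighbour,
-- that is, through N.
--
-- (⇐) For m = n − k, the bound |N_{G_m}(v_m)| ≥ k makes v_m adjacent to
-- all of G_m, so G_m is a clique, being the closed neighbourhood of v_m in
-- G_m.  If |S| < k, some vertex r of G_m avoids S, and every vertex outside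
-- S reaches r in G − S: a vertex of G_m is adjacent to r, and an earlier
-- vertex has k > |S| later neighbours, one of which avoids S.
module Submission where

open import Defs
open import Data.Nat as ℕ using (ℕ; _<_; _+_; _≤_; z≤n; s≤s; _∸_)
open import Data.Fin as Fin
  using (Fin; toℕ; zero; suc; _↑ʳ_; inject≤; fromℕ<; opposite; punchIn; punchOut)
open import Data.Fin.Subset using (∣_∣)
open import Data.Fin.Permutation using (Permutation′)
open import Function.Bundles using (_⇔_; mk⇔; Equivalence; Injection)

open import Data.Bool using (Bool; T)
open import Data.Bool.Properties using (T-≡; T-∧)
open import Data.Empty using (⊥-elim)
import Data.Fin.Properties as Finₚ
open import Data.Fin.Induction using (>-wellFounded)
open import Data.Fin.Permutation using (_⟨$⟩ʳ_; _⟨$⟩ˡ_; inverseˡ; inverseʳ)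
open import Data.Fin.Subset using (Subset; _∈_; _∉_; _─_; _-_; ⁅_⁆; inside; outside)
open import Data.Fin.Subset.Properties
  using (_∈?_; x∈⁅x⁆; p⊆q⇒∣p∣≤∣q∣; x∈p⇒∣p-x∣<∣p∣; x∈p∧x≢y⇒x∈p-y; p─q⊆p; p─⊥≡p;
         Empty-unique; ∣⊥∣≡0)
import Data.Nat.Properties as ℕₚ
open import Data.Product using (_×_; _,_; proj₁; proj₂; ∃-syntax)
open import Data.Sum using (_⊎_; inj₁; inj₂)
open import Data.Vec using (_∷_; tabulate; here; there)
open import Data.Vec.Properties using (lookup∘tabulate; []=⇒lookup; lookup⇒[]=)
open import Function using (_∘_; const)
open import Function.Definitions using (Injective)
open import Function.Properties.Inverse using (↔⇒↣)
open import Induction.WellFounded using (module All)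
open import Relation.Binary.PropositionalEquality
  using (_≡_; _≢_; refl; trans; cong; subst; subst₂; module ≡-Reasoning)
import Relation.Binary.PropositionalEquality as ≡
open import Relation.Nullary using (¬_; Dec; yes; no; does; contradiction)
open import Relation.Nullary.Decidable using (decidable-stable; _→-dec_)

private
  variable
    c n : ℕ
    p q : Subset n
    x y : Fin n

x∈p─q⇒x∉q : ∀ (p q : Subset n) → x ∈ p ─ q → x ∉ q
x∈p─q⇒x∉q (_ ∷ p) (inside  ∷ q) (there x∈p─q) (there x∈q) = x∈p─q⇒x∉q p q x∈p─q x∈q
x∈p─q⇒x∉q (_ ∷ p) (outside ∷ q) (there x∈p─q) (there x∈q) = x∈p─q⇒x∉q p q x∈p─q x∈q

x∈p-y⇒x≢y : x ∈ p - y → x ≢ y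
x∈p-y⇒x≢y {p = p} {y = y} x∈p-y refl = x∈p─q⇒x∉q p ⁅ y ⁆ x∈p-y (x∈⁅x⁆ y)

∣p∣≤1+∣p-x∣ : ∀ (p : Subset n) x → ∣ p ∣ ≤ ℕ.suc ∣ p - x ∣
∣p∣≤1+∣p-x∣ (inside  ∷ p) zero    = s≤s (ℕₚ.≤-reflexive (cong ∣_∣ (≡.sym (p─⊥≡p p))))
∣p∣≤1+∣p-x∣ (outside ∷ p) zero    = ℕₚ.m≤n⇒m≤1+n (ℕₚ.≤-reflexive (cong ∣_∣ (≡.sym (p─⊥≡p p))))
∣p∣≤1+∣p-x∣ (inside  ∷ p) (suc x) = s≤s (∣p∣≤1+∣p-x∣ p x)
∣p∣≤1+∣p-x∣ (outside ∷ p) (suc x) = ∣p∣≤1+∣p-x∣ p x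

∈-tabulate⇔ : ∀ {f : Fin n → Bool} → x ∈ tabulate f ⇔ T (f x)
∈-tabulate⇔ {x = x} {f} = mk⇔
  (λ x∈ → Equivalence.from T-≡ (trans (≡.sym (lookup∘tabulate f x)) ([]=⇒lookup x∈)))
  (λ Tfx → lookup⇒[]= x _ (trans (lookup∘tabulate f x) (Equivalence.to T-≡ Tfx)))

T-does : ∀ {A : Set} (a? : Dec A) → T (does a?) ⇔ A
T-does (yes a) = mk⇔ (const a) (const _)
T-does (no ¬a) = mk⇔ (λ ()) ¬a

injective⇒≤∣p∣ : (f : Fin c → Fin n) → Injective _≡_ _≡_ f → (∀ t → f t ∈ p) → c ≤ ∣ p ∣
injective⇒≤∣p∣ {ℕ.zero}  f _   _   = z≤n
injective⇒≤∣p∣ {ℕ.suc c} f inj f∈p = ℕₚ.≤-<-trans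
  (injective⇒≤∣p∣ (f ∘ suc) (Finₚ.suc-injective ∘ inj)
    (λ t → x∈p∧x≢y⇒x∈p-y (f∈p (suc t)) (Finₚ.0≢1+n ∘ ≡.sym ∘ inj)))
  (x∈p⇒∣p-x∣<∣p∣ (f∈p zero))

covered⇒∣p∣≤ : (f : Fin c → Fin n) → (∀ {x} → x ∈ p → ∃[ t ] f t ≡ x) → ∣ p ∣ ≤ c
covered⇒∣p∣≤ {ℕ.zero} {n} f cover = ℕₚ.≤-reflexive (trans
  (cong ∣_∣ (Empty-unique λ (_ , x∈p) → Finₚ.¬Fin0 (proj₁ (cover x∈p))))
  (∣⊥∣≡0 n))
covered⇒∣p∣≤ {ℕ.suc c} {p = p} f cover =
  ℕₚ.≤-trans (∣p∣≤1+∣p-x∣ p (f zero)) (s≤s (covered⇒∣p∣≤ (f ∘ suc) cover′))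
  where
  cover′ : x ∈ p - f zero → ∃[ t ] f (suc t) ≡ x
  cover′ x∈p-f0 with cover (p─q⊆p p ⁅ f zero ⁆ x∈p-f0)
  ... | zero  , f0≡x = contradiction (≡.sym f0≡x) (x∈p-y⇒x≢y x∈p-f0)
  ... | suc t , ft≡x = t , ft≡x

covered∧≤∣p∣⇒image⊆p : (f : Fin c → Fin n) → (∀ {x} → x ∈ p → ∃[ t ] f t ≡ x) →
                       c ≤ ∣ p ∣ → ∀ t → f t ∈ p
covered∧≤∣p∣⇒image⊆p {ℕ.suc c} {p = p} f cover c≤∣p∣ t with f t ∈? p
... | yes ft∈p = ft∈p
... | no  ft∉p = contradiction (covered⇒∣p∣≤ (f ∘ punchIn t) cover′) (ℕₚ.<⇒≱ c≤∣p∣)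
  where
  cover′ : x ∈ p → ∃[ s ] f (punchIn t s) ≡ x
  cover′ x∈p with cover x∈p
  ... | s , fs≡x with t Fin.≟ s
  ...   | yes refl = contradiction (subst (_∈ p) (≡.sym fs≡x) x∈p) ft∉p
  ...   | no  t≢s  = punchOut t≢s , trans (cong f (Finₚ.punchIn-punchOut t≢s)) fs≡x

∣p∣<c⇒∃∉p : (f : Fin c → Fin n) → Injective _≡_ _≡_ f → ∣ p ∣ < c → ∃[ t ] f t ∉ p
∣p∣<c⇒∃∉p {c} {p = p} f inj ∣p∣<c =
  Finₚ.¬∀⟶∃¬ c (λ t → f t ∈ p) (λ t → f t ∈? p) (ℕₚ.<⇒≱ ∣p∣<c ∘ injective⇒≤∣p∣ f inj)

∣p∣<∣q∣⇒∃∈q∉p : ∣ p ∣ < ∣ q ∣ → ∃[ x ] (x ∈ q × x ∉ p)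
∣p∣<∣q∣⇒∃∈q∉p {n} {p} {q} ∣p∣<∣q∣
  with Finₚ.¬∀⟶∃¬ n (λ x → x ∈ q → x ∈ p) (λ x → x ∈? q →-dec x ∈? p)
         (λ q⊆p → ℕₚ.<⇒≱ ∣p∣<∣q∣ (p⊆q⇒∣p∣≤∣q∣ (q⊆p _)))
... | x , q⊈p = x , decidable-stable (x ∈? q) (λ x∉q → q⊈p (⊥-elim ∘ x∉q)) , q⊈p ∘ const

module _ (a : ℕ) (a+c≤n : a + c ≤ n) where

  window : Fin c → Fin n
  window t = inject≤ (a ↑ʳ t) a+c≤n

  toℕ-window : ∀ t → toℕ (window t) ≡ a + toℕ t
  toℕ-window t = trans (Finₚ.toℕ-inject≤ (a ↑ʳ t) a+c≤n) (Finₚ.toℕ-↑ʳ a t)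

  window-injective : Injective _≡_ _≡_ window
  window-injective {s} {t} = Finₚ.↑ʳ-injective a s t ∘ Finₚ.inject≤-injective a+c≤n a+c≤n _ _

  window-covers : a ≤ toℕ x → toℕ x < a + c → ∃[ t ] window t ≡ x
  window-covers {x} a≤x x<a+c = fromℕ< x∸a<c , Finₚ.toℕ-injective (begin
    toℕ (window (fromℕ< x∸a<c)) ≡⟨ toℕ-window _ ⟩
    a + toℕ (fromℕ< x∸a<c)      ≡⟨ cong (a +_) (Finₚ.toℕ-fromℕ< x∸a<c) ⟩
    a + (toℕ x ∸ a)              ≡⟨ ℕₚ.m+[n∸m]≡n a≤x ⟩
    toℕ x                        ∎)
    where
    open ≡-Reasoning
    x∸a<c : toℕ x ∸ a < c
    x∸a<c = ℕₚ.+-cancelˡ-< a _ _ (subst (_< a + c) (≡.sym (ℕₚ.m+[n∸m]≡n a≤x)) x<a+c)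

module _ (G : Graph n) where

  data Walk (P : Fin n → Set) : Fin n → Fin n → Set where
    stay : ∀ {x} → P x → Walk P x x
    move : ∀ {x y z} → P x → Adj G x y → Walk P y z → Walk P x z

  private
    variable
      P Q : Fin n → Set
      S : Subset n
      a b z : Fin n

  source : Walk P a b → P a
  source (stay pa)     = pa
  source (move pa _ _) = pa

  Walk-map : (∀ {x} → P x → Q x) → Walk P a b → Walk Q a b
  Walk-map f (stay pa)       = stay (f pa)
  Walk-map f (move pa a~y w) = move (f pa) a~y (Walk-map f w)

  ReachAvoiding⇒Walk : ReachAvoiding G S a b → Walk (_∉ S) a b
  ReachAvoiding⇒Walk (here a∉S)        = stay a∉S
  ReachAvoiding⇒Walk (there a∉S a~y r) = move a∉S a~y (ReachAvoiding⇒Walk r)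

  ReachAvoiding-source : ReachAvoiding G S a b → a ∉ S
  ReachAvoiding-source (here a∉S)      = a∉S
  ReachAvoiding-source (there a∉S _ _) = a∉S

  ReachAvoiding-trans : ReachAvoiding G S a b → ReachAvoiding G S b z → ReachAvoiding G S a z
  ReachAvoiding-trans (here _)          r = r
  ReachAvoiding-trans (there a∉S a~y w) r = there a∉S a~y (ReachAvoiding-trans w r)

  ReachAvoiding-sym : ReachAvoiding G S a b → ReachAvoiding G S b a
  ReachAvoiding-sym (here a∉S)        = here a∉S
  ReachAvoiding-sym (there a∉S a~y r) = ReachAvoiding-trans (ReachAvoiding-sym r)
    (there (ReachAvoiding-source r) (sym G a~y) (here a∉S))

  module _ (clique : ∀ {x y} → P x → P y → Adj G z x → Adj G z y → x ≢ y → Adj G x y) where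

    Walk-bypass : a ≢ z → b ≢ z → Walk P a b → Walk (λ x → P x × x ≢ z) a b
    Walk-bypass a≢z b≢z (stay pa) = stay (pa , a≢z)
    Walk-bypass {a} a≢z b≢z (move {y = y} pa a~y w) with y Fin.≟ z | w
    ... | no  y≢z | _ = move (pa , a≢z) a~y (Walk-bypass y≢z b≢z w)
    ... | yes refl | stay _ = contradiction refl b≢z
    ... | yes refl | move {y = y′} _ z~y′ w′ with a Fin.≟ y′
    ...   | yes refl = Walk-bypass a≢z b≢z w′
    ...   | no  a≢y′ =
      move (pa , a≢z) (clique pa (source w′) (sym G a~y) z~y′ a≢y′) (Walk-bypass y′≢z b≢z w′)
      where
      y′≢z : y′ ≢ z
      y′≢z refl = irrefl G z~y′

module _ (G : Graph n) (σ : Permutation′ n) where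

  vertex : Fin n → Fin n
  vertex i = σ ⟨$⟩ʳ i

  position : Fin n → Fin n
  position x = σ ⟨$⟩ˡ x

  private
    variable
      i j l : Fin n
      d : ℕ
      S : Subset n
      a b : Fin n

    N : Fin n → Subset n
    N = NbrInGi G σ

  vertex-injective : Injective _≡_ _≡_ vertex
  vertex-injective = Injection.injective (↔⇒↣ σ)

  position⇒vertex : position x ≡ i → x ≡ vertex i
  position⇒vertex refl = ≡.sym (inverseʳ σ)

  vertex⇒position : x ≡ vertex i → position x ≡ i
  vertex⇒position refl = inverseˡ σ

  ∈NbrInGi⁻ : x ∈ N i → Adj G (vertex i) x × i Fin.< position x
  ∈NbrInGi⁻ {x} {i} x∈N with Equivalence.to T-∧ (Equivalence.to ∈-tabulate⇔ x∈N)
  ... | adj , later =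
    Equivalence.to (T-does (adj? G _ x)) adj , Equivalence.to (T-does (i Fin.<? _)) later

  ∈NbrInGi⁺ : Adj G (vertex i) x → i Fin.< position x → x ∈ N i
  ∈NbrInGi⁺ {i} {x} adj later = Equivalence.from ∈-tabulate⇔ (Equivalence.from T-∧
    (Equivalence.from (T-does (adj? G _ x)) adj , Equivalence.from (T-does (i Fin.<? _)) later))

  NbrInGi-irrefl : vertex i ∉ N i
  NbrInGi-irrefl = irrefl G ∘ proj₁ ∘ ∈NbrInGi⁻

  InSuffix : ℕ → Subset n → Fin n → Set
  InSuffix d S x = x ∉ S × d ≤ toℕ (position x)

  module _ (peo : PerfectEliminationOrder G σ) where

    later-neighbours-adjacent : j Fin.≤ position a → j Fin.≤ position b →
      Adj G (vertex j) a → Adj G (vertex j) b → a ≢ b → Adj G a b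
    later-neighbours-adjacent {j} {a} {b} j≤a j≤b j~a j~b a≢b =
      subst₂ (Adj G) (inverseʳ σ) (inverseʳ σ)
        (peo j (position a) (position b) j≤a j≤b (inj₂ (toPosition j~a)) (inj₂ (toPosition j~b))
          (a≢b ∘ λ e → trans (position⇒vertex e) (inverseʳ σ)))
      where
      toPosition : Adj G (vertex j) x → Adj G (vertex j) (vertex (position x))
      toPosition = subst (Adj G (vertex j)) (≡.sym (inverseʳ σ))

    Walk-raise : toℕ j ≡ d → d < toℕ (position a) → d < toℕ (position b) →
      Walk G (InSuffix d S) a b → Walk G (InSuffix (ℕ.suc d) S) a b
    Walk-raise {j} {d} j≡d d<a d<b w =
      Walk-map G raise (Walk-bypass G clique (≢vertex d<a) (≢vertex d<b) w)
      where
      ≢vertex : d < toℕ (position x) → x ≢ vertex j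
      ≢vertex d<x x≡j =
        ℕₚ.<⇒≢ d<x (trans (≡.sym j≡d) (cong toℕ (≡.sym (vertex⇒position x≡j))))
      clique : InSuffix d S x → InSuffix d S y →
        Adj G (vertex j) x → Adj G (vertex j) y → x ≢ y → Adj G x y
      clique (_ , d≤x) (_ , d≤y) = later-neighbours-adjacent
        (subst (_≤ _) (≡.sym j≡d) d≤x) (subst (_≤ _) (≡.sym j≡d) d≤y)
      raise : InSuffix d S x × x ≢ vertex j → InSuffix (ℕ.suc d) S x
      raise ((x∉S , d≤x) , x≢j) = x∉S , ℕₚ.≤∧≢⇒< d≤x λ d≡x →
        x≢j (position⇒vertex (Finₚ.toℕ-injective (trans (≡.sym d≡x) (≡.sym j≡d))))

    Walk-raise* : ∀ d → d ≤ toℕ (position a) → d ≤ toℕ (position b) →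
      Walk G (InSuffix 0 S) a b → Walk G (InSuffix d S) a b
    Walk-raise* ℕ.zero    _   _   w = w
    Walk-raise* (ℕ.suc d) d<a d<b w =
      Walk-raise (Finₚ.toℕ-fromℕ< d<n) d<a d<b (Walk-raise* d (ℕₚ.<⇒≤ d<a) (ℕₚ.<⇒≤ d<b) w)
      where
      d<n : d < n
      d<n = ℕₚ.<-trans d<a (Finₚ.toℕ<n _)

    later-unreachable : i Fin.< position a → ¬ ReachAvoiding G (N i) (vertex i) a
    later-unreachable {i} i<a r = leaves-through-N i<a
      (Walk-raise* (toℕ i) (ℕₚ.≤-reflexive (cong toℕ (≡.sym (inverseˡ σ)))) (ℕₚ.<⇒≤ i<a)
        (Walk-map G (_, z≤n) (ReachAvoiding⇒Walk G r)))
      where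
      leaves-through-N : i Fin.< position b → ¬ Walk G (InSuffix (toℕ i) (N i)) (vertex i) b
      leaves-through-N i<i (stay _) = Finₚ.<-irrefl (≡.sym (inverseˡ σ)) i<i
      leaves-through-N _ (move _ i~y w) with source G w
      ... | y∉N , i≤y = y∉N (∈NbrInGi⁺ i~y (Finₚ.≤∧≢⇒< i≤y λ i≡y →
        irrefl G (subst (Adj G _) (position⇒vertex (≡.sym i≡y)) i~y)))

    KConnected⇒later-degree : ∀ {k} → KConnected k G → toℕ i + k < n → k ≤ ∣ N i ∣
    KConnected⇒later-degree {i} {k} kc i+k<n = ℕₚ.≮⇒≥ λ ∣N∣<k →
      let t , w∉N = ∣p∣<c⇒∃∉p (vertex ∘ next-k) (window-injective _ i+k<n ∘ vertex-injective) ∣N∣<k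
      in kc (N i) ∣N∣<k (vertex i , _ , NbrInGi-irrefl , w∉N , later-unreachable (i<next-k t))
      where
      next-k : Fin k → Fin n
      next-k = window (ℕ.suc (toℕ i)) i+k<n
      i<next-k : ∀ t → i Fin.< position (vertex (next-k t))
      i<next-k t = subst (i Fin.<_) (≡.sym (inverseˡ σ))
        (subst (toℕ i <_) (≡.sym (toℕ-window _ i+k<n t)) (s≤s (ℕₚ.m≤m+n _ _)))

    later-clique : (∀ {j} → i Fin.< j → Adj G (vertex i) (vertex j)) →
      i Fin.≤ j → i Fin.≤ l → j ≢ l → Adj G (vertex j) (vertex l)
    later-clique {i} adj i≤j i≤l =
      peo i _ _ i≤j i≤l (self-or-adjacent i≤j) (self-or-adjacent i≤l)
      where
      self-or-adjacent : i Fin.≤ j → j ≡ i ⊎ Adj G (vertex i) (vertex j)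
      self-or-adjacent {j} i≤j with j Fin.≟ i
      ... | yes j≡i = inj₁ j≡i
      ... | no  j≢i = inj₂ (adj (Finₚ.≤∧≢⇒< i≤j (j≢i ∘ ≡.sym)))

  later⊆NbrInGi : ∀ {k} → ℕ.suc (toℕ i + k) ≡ n → k ≤ ∣ N i ∣ → i Fin.< j → vertex j ∈ N i
  later⊆NbrInGi {i} {j} {k} i+k+1≡n k≤∣N∣ i<j =
    subst (_∈ N i) (cong vertex (proj₂ (in-window i<j)))
      (covered∧≤∣p∣⇒image⊆p (vertex ∘ window _ bound) cover k≤∣N∣ (proj₁ (in-window i<j)))
    where
    bound : ℕ.suc (toℕ i) + k ≤ n
    bound = ℕₚ.≤-reflexive i+k+1≡n
    in-window : i Fin.< l → ∃[ t ] window _ bound t ≡ l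
    in-window {l} i<l =
      window-covers _ bound i<l (subst (toℕ l <_) (≡.sym i+k+1≡n) (Finₚ.toℕ<n l))
    cover : x ∈ N i → ∃[ t ] vertex (window _ bound t) ≡ x
    cover x∈N with in-window (proj₂ (∈NbrInGi⁻ x∈N))
    ... | t , e = t , ≡.sym (position⇒vertex (≡.sym e))

  reaches-root : ∀ {r} → (∀ {j} → j Fin.< i → ∣ S ∣ < ∣ N j ∣) →
    (∀ {j} → i Fin.≤ j → vertex j ≢ r → Adj G (vertex j) r) →
    r ∉ S → a ∉ S → ReachAvoiding G S a r
  reaches-root {i} {S} {a} {r} early-degree adjacent-to-r r∉S a∉S =
    subst (λ x → ReachAvoiding G S x r) (inverseʳ σ)
      (All.wfRec >-wellFounded _ Reaches reach (position a) (subst (_∉ S) (≡.sym (inverseʳ σ)) a∉S))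
    where
    Reaches : Fin n → Set
    Reaches j = vertex j ∉ S → ReachAvoiding G S (vertex j) r
    reach : ∀ j → (∀ {l} → j Fin.< l → Reaches l) → Reaches j
    reach j reach-later j∉S with i Fin.≤? j
    ... | yes i≤j with vertex j Fin.≟ r
    ...   | yes refl = here j∉S
    ...   | no  j≢r  = there j∉S (adjacent-to-r i≤j j≢r) (here r∉S)
    reach j reach-later j∉S | no i≰j with ∣p∣<∣q∣⇒∃∈q∉p (early-degree (ℕₚ.≰⇒> i≰j))
    ... | x , x∈N , x∉S = there j∉S (proj₁ (∈NbrInGi⁻ x∈N))
      (subst (λ y → ReachAvoiding G S y r) (inverseʳ σ)
        (reach-later (proj₂ (∈NbrInGi⁻ x∈N)) (subst (_∉ S) (≡.sym (inverseʳ σ)) x∉S)))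

  later-degree⇒KConnected : PerfectEliminationOrder G σ → ∀ {k} → k < n →
    (∀ i → toℕ i + k < n → k ≤ ∣ N i ∣) → KConnected k G
  later-degree⇒KConnected peo {k} k<n degree S ∣S∣<k (x , y , x∉S , y∉S , x↛y) =
    x↛y (ReachAvoiding-trans G (reach x∉S) (ReachAvoiding-sym G (reach y∉S)))
    where
    m : Fin n
    m = opposite (fromℕ< k<n)
    toℕ-m : toℕ m ≡ n ∸ ℕ.suc k
    toℕ-m = trans (Finₚ.opposite-prop _) (cong (λ z → n ∸ ℕ.suc z) (Finₚ.toℕ-fromℕ< k<n))
    m+k+1≡n : ℕ.suc (toℕ m + k) ≡ n
    m+k+1≡n = begin
      ℕ.suc (toℕ m + k)     ≡⟨ ≡.sym (ℕₚ.+-suc (toℕ m) k) ⟩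
      toℕ m + ℕ.suc k       ≡⟨ cong (_+ ℕ.suc k) toℕ-m ⟩
      n ∸ ℕ.suc k + ℕ.suc k ≡⟨ ℕₚ.m∸n+n≡m k<n ⟩
      n                     ∎
      where open ≡-Reasoning
    bound : toℕ m + ℕ.suc k ≤ n
    bound = ℕₚ.≤-reflexive (trans (ℕₚ.+-suc (toℕ m) k) m+k+1≡n)
    last-k+1 : Fin (ℕ.suc k) → Fin n
    last-k+1 = window (toℕ m) bound
    root : ∃[ t ] vertex (last-k+1 t) ∉ S
    root = ∣p∣<c⇒∃∉p (vertex ∘ last-k+1) (window-injective _ bound ∘ vertex-injective)
      (ℕₚ.m≤n⇒m≤1+n ∣S∣<k)
    r : Fin n
    r = vertex (last-k+1 (proj₁ root))
    m≤r : m Fin.≤ last-k+1 (proj₁ root)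
    m≤r = subst (toℕ m ≤_) (≡.sym (toℕ-window _ bound (proj₁ root))) (ℕₚ.m≤m+n _ _)
    adjacent-to-r : m Fin.≤ j → vertex j ≢ r → Adj G (vertex j) r
    adjacent-to-r m≤j j≢r = later-clique peo
      (proj₁ ∘ ∈NbrInGi⁻ ∘ later⊆NbrInGi m+k+1≡n (degree m (ℕₚ.≤-reflexive m+k+1≡n)))
      m≤j m≤r (j≢r ∘ cong vertex)
    early-degree : j Fin.< m → ∣ S ∣ < ∣ N j ∣
    early-degree j<m = ℕₚ.<-≤-trans ∣S∣<k
      (degree _ (ℕₚ.<-trans (ℕₚ.+-monoˡ-< k j<m) (ℕₚ.≤-reflexive m+k+1≡n)))
    reach : ∀ {u} → u ∉ S → ReachAvoiding G S u r
    reach = reaches-root early-degree adjacent-to-r (proj₂ root)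

lemma3 : ∀ {n : ℕ} (G : Graph n) (σ : Permutation′ n) (k : ℕ) →
    Chordal G → PerfectEliminationOrder G σ → 1 ≤ k → k < n →
    (KConnected k G ⇔ (∀ (i : Fin n) → toℕ i + k < n → k ≤ ∣ NbrInGi G σ i ∣))
lemma3 G σ k _ peo _ k<n =
  mk⇔ (λ kc i → KConnected⇒later-degree G σ peo kc) (later-degree⇒KConnected G σ peo k<n)
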